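{- Let $N\ge2$ be an integer and $k$ a positive integer. Then: (i) $S^N(S^{2N}(k))=S^N(k)$; (ii) for every integer $m\ge1$, $S^N(S^{2^mN}(k))=S^N(k)$.
   Context: Alternating cycle function: for an integer $N\ge2$ and a positive integer $k$, let $q=\lfloor (k-1)/N\rfloor$ and $r=k-qN$. Set $S^N(k)=N+1-r$ if $q$ is even, and $S^N(k)=r$ if $q$ is odd. Thus $S^N$ maps positive integers to $\{1,\dots,N\}$. -}

module Defs where

open import Data.Nat using (ℕ; zero; suc; _+_; _*_; _∸_; _^_; NonZero)
open import Data.Nat.DivMod using (_/_; _%_)

S : (N : ℕ) → .{{_ : NonZero N}} → ℕ → ℕ
S N k with ((k ∸ 1) / N) % 2
... | zero  = (N + 1) ∸ (k ∸ ((k ∸ 1) / N) * N)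
... | suc _ = k ∸ ((k ∸ 1) / N) * N

-- Cut the positive integers into blocks of N: S N runs down N, …, 1 on the blocks of even index
-- and up 1, …, N on those of odd index. Hence S N is 2N-periodic and, inside a period,
-- symmetric under k ↦ 2N + 1 − k. S M k is either k′ or M + 1 − k′ for some k′ ≡ k (mod M);
-- when 2N ∣ M, S N sends both to S N k, by periodicity and by this symmetry respectively.
module Submission where

open import Defs
open import Data.Nat using (ℕ; zero; suc; _+_; _*_; _∸_; _^_; _≤_; _<_; z<s; NonZero)
open import Data.Nat.Properties
open import Data.Nat.DivMod
open import Data.Nat.Divisibility using (_∣_; divides; divides-refl; ∣-refl; m∣m*n; *-monoˡ-∣)
open import Data.Product using (_×_; _,_)
open import Relation.Nullary using (yes; no)
open import Relation.Binary.PropositionalEquality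
open ≡-Reasoning

sweep : ℕ → ℕ → ℕ → ℕ
sweep N r zero    = N ∸ r
sweep N r (suc _) = suc r

module _ {N : ℕ} .{{_ : NonZero N}} where

  1+m∸[m/n]*n≡1+m%n : ∀ x → suc x ∸ (x / N) * N ≡ suc (x % N)
  1+m∸[m/n]*n≡1+m%n x = trans (+-∸-assoc 1 (m/n*n≤m x N)) (cong suc (sym (m%n≡m∸m/n*n x N)))

  S-suc : ∀ x → S N (suc x) ≡ sweep N (x % N) ((x / N) % 2)
  S-suc x with (x / N) % 2
  ... | zero  = cong₂ _∸_ (+-comm N 1) (1+m∸[m/n]*n≡1+m%n x)
  ... | suc _ = 1+m∸[m/n]*n≡1+m%n x

  S-block : ∀ {r} q → r < N → S N (suc (r + q * N)) ≡ sweep N r (q % 2)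
  S-block {r} q r<N = begin
    S N (suc (r + q * N))                             ≡⟨ S-suc (r + q * N) ⟩
    sweep N ((r + q * N) % N) ((r + q * N) / N % 2)   ≡⟨ cong₂ (sweep N) offset (cong (_% 2) index) ⟩
    sweep N r (q % 2)                                 ∎
    where
    offset : (r + q * N) % N ≡ r
    offset = trans ([m+kn]%n≡m%n r q N) (m<n⇒m%n≡m r<N)
    index : (r + q * N) / N ≡ q
    index = trans (+-distrib-/-∣ʳ r (divides-refl q)) (cong₂ _+_ (m<n⇒m/n≡0 r<N) (m*n/n≡m q N))

  S-periodic : ∀ y u → S N (suc y + u * (2 * N)) ≡ S N (suc y)
  S-periodic y u = begin
    S N (suc (y + u * (2 * N)))                         ≡⟨ cong (λ t → S N (suc (y + t))) (*-assoc u 2 N) ⟨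
    S N (suc (y + u * 2 * N))                           ≡⟨ S-suc (y + u * 2 * N) ⟩
    sweep N ((y + u * 2 * N) % N) ((y + u * 2 * N) / N % 2)
      ≡⟨ cong₂ (sweep N) ([m+kn]%n≡m%n y (u * 2) N) parity ⟩
    sweep N (y % N) (y / N % 2)                         ≡⟨ S-suc y ⟨
    S N (suc y)                                         ∎
    where
    parity : (y + u * 2 * N) / N % 2 ≡ y / N % 2
    parity = begin
      (y + u * 2 * N) / N % 2      ≡⟨ cong (_% 2) (+-distrib-/-∣ʳ y (divides-refl (u * 2))) ⟩
      (y / N + u * 2 * N / N) % 2  ≡⟨ cong (λ t → (y / N + t) % 2) (m*n/n≡m (u * 2) N) ⟩
      (y / N + u * 2) % 2          ≡⟨ [m+kn]%n≡m%n (y / N) u 2 ⟩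
      y / N % 2                    ∎

  S-mirror : ∀ {r} → r < 2 * N → S N (2 * N ∸ r) ≡ S N (suc r)
  S-mirror {r} r<2N with r <? N
  ... | yes r<N = begin
    S N (N + (N + 0) ∸ r)          ≡⟨ cong (λ t → S N (N + t ∸ r)) (+-identityʳ N) ⟩
    S N (N + N ∸ r)                ≡⟨ cong (S N) (+-∸-comm N (<⇒≤ r<N)) ⟩
    S N (N ∸ r + N)                ≡⟨ cong (λ t → S N (t + N)) (+-∸-assoc 1 r<N) ⟩
    S N (suc (N ∸ suc r + N))      ≡⟨ cong (λ t → S N (suc (N ∸ suc r + t))) (*-identityˡ N) ⟨
    S N (suc (N ∸ suc r + 1 * N))  ≡⟨ S-block 1 (∸-monoʳ-< z<s r<N) ⟩
    suc (N ∸ suc r)                ≡⟨ +-∸-assoc 1 r<N ⟨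
    N ∸ r                          ≡⟨ S-block 0 r<N ⟨
    S N (suc (r + 0 * N))          ≡⟨ cong (λ t → S N (suc t)) (+-identityʳ r) ⟩
    S N (suc r)                    ∎
  ... | no r≮N = begin
    S N (2 * N ∸ r)                ≡⟨ cong (λ t → S N (2 * N ∸ t)) N+s≡r ⟨
    S N (N + (N + 0) ∸ (N + s))    ≡⟨ cong (S N) ([m+n]∸[m+o]≡n∸o N (N + 0) s) ⟩
    S N (N + 0 ∸ s)                ≡⟨ cong (λ t → S N (t ∸ s)) (+-identityʳ N) ⟩
    S N (N ∸ s)                    ≡⟨ cong (S N) (+-∸-assoc 1 s<N) ⟩
    S N (suc (N ∸ suc s))          ≡⟨ cong (λ t → S N (suc t)) (+-identityʳ (N ∸ suc s)) ⟨
    S N (suc (N ∸ suc s + 0 * N))  ≡⟨ S-block 0 (∸-monoʳ-< z<s s<N) ⟩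
    N ∸ (N ∸ suc s)                ≡⟨ m∸[m∸n]≡n s<N ⟩
    suc s                          ≡⟨ S-block 1 s<N ⟨
    S N (suc (s + 1 * N))          ≡⟨ cong (λ t → S N (suc t)) (trans (cong (s +_) (*-identityˡ N)) (+-comm s N)) ⟩
    S N (suc (N + s))              ≡⟨ cong (λ t → S N (suc t)) N+s≡r ⟩
    S N (suc r)                    ∎
    where
    s = r ∸ N
    N+s≡r : N + s ≡ r
    N+s≡r = m+[n∸m]≡n (≮⇒≥ r≮N)
    s<N : s < N
    s<N = +-cancelˡ-< N s N (subst (_< N + N) (sym N+s≡r) (subst (λ t → r < N + t) (+-identityʳ N) r<2N))

  S-mirror-multiple : ∀ d {r} → r < d * (2 * N) → S N (d * (2 * N) ∸ r) ≡ S N (suc r)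
  S-mirror-multiple zero ()
  S-mirror-multiple (suc d) {r} r<M with r <? 2 * N
  ... | yes r<2N = begin
    S N (2 * N + d * (2 * N) ∸ r)           ≡⟨ cong (S N) (+-∸-comm (d * (2 * N)) (<⇒≤ r<2N)) ⟩
    S N (2 * N ∸ r + d * (2 * N))           ≡⟨ cong (λ t → S N (t + d * (2 * N))) (+-∸-assoc 1 r<2N) ⟩
    S N (suc (2 * N ∸ suc r) + d * (2 * N)) ≡⟨ S-periodic (2 * N ∸ suc r) d ⟩
    S N (suc (2 * N ∸ suc r))               ≡⟨ cong (S N) (+-∸-assoc 1 r<2N) ⟨
    S N (2 * N ∸ r)                         ≡⟨ S-mirror r<2N ⟩
    S N (suc r)                             ∎
  ... | no r≮2N = begin
    S N (2 * N + d * (2 * N) ∸ r)           ≡⟨ cong (λ t → S N (2 * N + d * (2 * N) ∸ t)) 2N+s≡r ⟨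
    S N (2 * N + d * (2 * N) ∸ (2 * N + s)) ≡⟨ cong (S N) ([m+n]∸[m+o]≡n∸o (2 * N) (d * (2 * N)) s) ⟩
    S N (d * (2 * N) ∸ s)                   ≡⟨ S-mirror-multiple d s<dM ⟩
    S N (suc s)                             ≡⟨ S-periodic s 1 ⟨
    S N (suc s + 1 * (2 * N))               ≡⟨ cong (λ t → S N (suc t)) (trans (cong (s +_) (*-identityˡ (2 * N))) (+-comm s (2 * N))) ⟩
    S N (suc (2 * N + s))                   ≡⟨ cong (λ t → S N (suc t)) 2N+s≡r ⟩
    S N (suc r)                             ∎
    where
    s = r ∸ 2 * N
    2N+s≡r : 2 * N + s ≡ r
    2N+s≡r = m+[n∸m]≡n (≮⇒≥ r≮2N)
    s<dM : s < d * (2 * N)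
    s<dM = +-cancelˡ-< (2 * N) s (d * (2 * N)) (subst (_< suc d * (2 * N)) (sym 2N+s≡r) r<M)

S∘S-multiple≡S : ∀ N M .{{_ : NonZero N}} .{{_ : NonZero M}} → 2 * N ∣ M →
                 ∀ x → S N (S M (suc x)) ≡ S N (suc x)
S∘S-multiple≡S N M (divides d M≡d*2N) x = begin
  S N (S M (suc x))             ≡⟨ cong (λ t → S N (S M (suc t))) x≡r+q*M ⟩
  S N (S M (suc (r + q * M)))   ≡⟨ cong (S N) (S-block q r<M) ⟩
  S N (sweep M r (q % 2))       ≡⟨ by-parity (q % 2) ⟩
  S N (suc r)                   ≡⟨ S-periodic r (q * d) ⟨
  S N (suc r + q * d * (2 * N)) ≡⟨ cong (λ t → S N (suc r + t)) q*M≡q*d*2N ⟨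
  S N (suc (r + q * M))         ≡⟨ cong (λ t → S N (suc t)) x≡r+q*M ⟨
  S N (suc x)                   ∎
  where
  r = x % M
  q = x / M
  r<M = m%n<n x M
  x≡r+q*M = m≡m%n+[m/n]*n x M
  q*M≡q*d*2N : q * M ≡ q * d * (2 * N)
  q*M≡q*d*2N = trans (cong (q *_) M≡d*2N) (sym (*-assoc q d (2 * N)))
  by-parity : ∀ b → S N (sweep M r b) ≡ S N (suc r)
  by-parity zero    = trans (cong (λ m → S N (m ∸ r)) M≡d*2N) (S-mirror-multiple d (subst (r <_) M≡d*2N r<M))
  by-parity (suc _) = refl

proposition5 : (N k : ℕ) → .{{_ : NonZero N}} → 2 ≤ N → 1 ≤ k →
    (S N (S (2 * N) {{m*n≢0 2 N}} k) ≡ S N k)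
    × ((m : ℕ) → 1 ≤ m → S N (S (2 ^ m * N) {{m*n≢0 (2 ^ m) N {{m^n≢0 2 m}}}} k) ≡ S N k)
proposition5 N (suc x) _ _ =
    S∘S-multiple≡S N (2 * N) {{_}} {{m*n≢0 2 N}} ∣-refl x
  , λ { (suc m) _ → S∘S-multiple≡S N (2 ^ suc m * N) {{_}} {{m*n≢0 (2 ^ suc m) N {{m^n≢0 2 (suc m)}}}}
                                  (*-monoˡ-∣ N (m∣m*n {2} (2 ^ m))) x }
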